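{- Let $G$ and $H$ be finite, simple, connected graphs, each with at least two vertices. Then $G$ and $H$ are both extreme geodesic if and only if $G\boxtimes H$ is extreme geodesic.
   Context: A vertex is simplicial if its neighborhood induces a complete graph; $Ext(G)$ denotes the set of simplicial vertices of $G$. For a connected graph, $I[x,y]$ consists of $x$, $y$ and all vertices on some shortest $x$–$y$ path; $I[S]=\bigcup_{u,v\in S}I[u,v]$; $S$ is geodetic if $I[S]$ is the whole vertex set. A graph $G$ is extreme geodesic if $Ext(G)$ is a geodetic set of $G$. The strong product $G\boxtimes H$ has vertex set $V(G)\times V(H)$, with $(g,h)$ and $(g',h')$ adjacent whenever ($g=g'$ and $hh'\in E(H)$), or ($h=h'$ and $gg'\in E(G)$), or ($gg'\in E(G)$ and $hh'\in E(H)$). -}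

module Defs where

open import Data.Nat using (ℕ; zero; suc; _<_)
open import Data.Fin using (Fin)
open import Data.Product using (Σ; ∃; _×_; _,_)
open import Data.Sum using (_⊎_; inj₁; inj₂)
open import Data.Empty using (⊥)
open import Relation.Nullary using (¬_)
open import Relation.Binary.PropositionalEquality using (_≡_; _≢_; refl)

record Graph (V : Set) : Set₁ where
  field
    Adj     : V → V → Set
    symAdj  : ∀ {x y} → Adj x y → Adj y x
    irrefl  : ∀ {x} → ¬ Adj x x
open Graph public

module _ {V : Set} (G : Graph V) where

  data Walk : V → V → ℕ → Set where
    here : ∀ {x} → Walk x x 0
    step : ∀ {x y z k} → Adj G x y → Walk y z k → Walk x z (suc k)

  data OnWalk (z : V) : ∀ {x y k} → Walk x y k → Set where
    on-here : ∀ {y k} {w : Walk z y k} → OnWalk z w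
    on-there : ∀ {x y u k} {a : Adj G x u} {w : Walk u y k} →
               OnWalk z w → OnWalk z (step a w)

  Connected : Set
  Connected = ∀ x y → ∃ λ k → Walk x y k

  Shortest : ∀ {x y k} → Walk x y k → Set
  Shortest {x} {y} {k} _ = ∀ j → j < k → ¬ Walk x y j

  Interval : V → V → V → Set
  Interval x y z = ∃ λ k → Σ (Walk x y k) λ w → Shortest w × OnWalk z w

  Geodetic : (V → Set) → Set
  Geodetic S = ∀ z → ∃ λ u → ∃ λ v → S u × S v × Interval u v z

  Simplicial : V → Set
  Simplicial x = ∀ y y' → Adj G x y → Adj G x y' → y ≢ y' → Adj G y y'

  ExtremeGeodesic : Set
  ExtremeGeodesic = Geodetic Simplicial

StrongAdj : ∀ {A B : Set} → Graph A → Graph B → A × B → A × B → Set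
StrongAdj G H (g , h) (g' , h') =
  (g ≡ g' × Adj H h h') ⊎ (h ≡ h' × Adj G g g') ⊎ (Adj G g g' × Adj H h h')

_⊠_ : ∀ {A B : Set} → Graph A → Graph B → Graph (A × B)
G ⊠ H = record
  { Adj = StrongAdj G H
  ; symAdj = sy
  ; irrefl = ir
  }
  where
  sy : ∀ {x y} → StrongAdj G H x y → StrongAdj G H y x
  sy (inj₁ (refl , a)) = inj₁ (refl , symAdj H a)
  sy (inj₂ (inj₁ (refl , a))) = inj₂ (inj₁ (refl , symAdj G a))
  sy (inj₂ (inj₂ (a , b))) = inj₂ (inj₂ (symAdj G a , symAdj H b))
  ir : ∀ {x} → ¬ StrongAdj G H x x
  ir (inj₁ (_ , a)) = irrefl H a
  ir (inj₂ (inj₁ (_ , a))) = irrefl G a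
  ir (inj₂ (inj₂ (a , _))) = irrefl G a

module Submission where

-- (⇒) Let (g , h) be a vertex of G ⊠ H, with g on a geodesic γ of G and h
-- on a geodesic δ of H, all four endpoints simplicial; say h is at most as
-- close to an endpoint e of δ as g is to either endpoint of γ.  Following γ
-- in the first coordinate while the second goes from e to h and back
-- (pausing where needed) is a walk through (g , h) between the simplicial
-- vertices (u , e), (v , e); it is a geodesic since projecting a product walk
-- to G never lengthens it.  The other case follows by swapping the factors.
--
-- (⇐) Take a simplicial h in H (a coordinate of a simplicial vertex of
-- G ⊠ H) and a product geodesic through (g , h).  Its G-projection passes g
-- and is no longer.  Its H-projection can bypass the simplicial vertex h, so
-- it is strictly shorter; as a product walk is as long as the longer of its
-- projections, no G-walk beats the G-projection, which is thus a geodesic.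

open import Defs
open import Data.Nat using (ℕ; zero; suc; _+_; _⊔_; _⊓_; _≤_; _<_; _≥_; z≤n; s≤s)
open import Data.Nat.Properties
  using (≤-total; ≤-trans; ≤-<-trans; <-≤-trans; m≤n⇒m≤1+n; +-mono-≤; +-monoʳ-≤; n≤1+n; ≤-refl;
         m<m+n; m<n+m; ⊔-lub; m≤n⇒m⊔n≡n; m≥n⇒m⊔n≡m; m≤n⇒m⊓n≡m; m≥n⇒m⊓n≡n; m⊓n≤m; m⊓n≤n)
open import Data.Fin using (Fin) renaming (zero to fzero)
import Data.Fin.Properties as Fin
open import Data.Product using (Σ; ∃; _×_; _,_; proj₁; proj₂; swap)
open import Data.Sum using (_⊎_; inj₁; inj₂)
open import Data.Empty using (⊥; ⊥-elim)
open import Relation.Nullary using (¬_; yes; no)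
open import Relation.Binary.Definitions using (DecidableEquality)
open import Relation.Binary.PropositionalEquality using (_≡_; _≢_; refl; sym; cong; cong₂; subst)
open import Function.Bundles using (_⇔_; mk⇔)

module Walks {V : Set} (G : Graph V) where

  private variable
    x y z : V
    a b i j k n : ℕ

  append : Walk G x y i → Walk G y z j → Walk G x z (i + j)
  append here w = w
  append (step e v) w = step e (append v w)

  onAppend : (v : Walk G x y i) (w : Walk G y z j) → OnWalk G y (append v w)
  onAppend here w = on-here
  onAppend (step e v) w = on-there (onAppend v w)

  snoc : Walk G x y n → Adj G y z → Walk G x z (suc n)
  snoc here e = step e here
  snoc (step e' w) e = step e' (snoc w e)

  reverse : Walk G x y n → Walk G y x n
  reverse here = here
  reverse (step e w) = snoc (reverse w) (symAdj G e)

  stationary : Walk G x y 0 → x ≡ y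
  stationary here = refl

  splitAt : {w : Walk G x y n} → OnWalk G z w →
            Σ ℕ λ i → Σ ℕ λ j → Walk G x z i × Walk G z y j × i + j ≡ n
  splitAt {w = w} on-here = 0 , _ , here , w , refl
  splitAt (on-there {a = e} o) with splitAt o
  ... | i , j , p , q , refl = suc i , j , step e p , q , refl

  record OnGeodesic (x z y : V) : Set where
    constructor through
    field
      before after : ℕ
      toZ : Walk G x z before
      fromZ : Walk G z y after
      minimal : ∀ l → l < before + after → ¬ Walk G x y l
  open OnGeodesic public

  onGeodesic : Interval G x y z → OnGeodesic x z y
  onGeodesic (_ , _ , minimal , on) with splitAt on
  ... | i , j , p , q , refl = through i j p q minimal

  interval : OnGeodesic x z y → Interval G x y z
  interval (through i j p q minimal) = i + j , append p q , minimal , onAppend p q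

  trivialInterval : Interval G x x x
  trivialInterval = 0 , here , (λ _ ()) , on-here

  nearerEnd : {S : V → Set} → S x → S y → (γ : OnGeodesic x z y) →
              Σ V λ e → S e × Walk G z e (before γ ⊓ after γ)
  nearerEnd sx sy (through i j p q _) with ≤-total i j
  ... | inj₁ i≤j = _ , sx , subst (Walk G _ _) (sym (m≤n⇒m⊓n≡m i≤j)) (reverse p)
  ... | inj₂ j≤i = _ , sy , subst (Walk G _ _) (sym (m≥n⇒m⊓n≡n j≤i)) q

  -- Lazy walks may stay put; they are the shadows of product walks in a factor.
  data LazyWalk : V → V → ℕ → Set where
    lhere : LazyWalk x x 0
    lstay : LazyWalk x y n → LazyWalk x y (suc n)
    lstep : Adj G x y → LazyWalk y z n → LazyWalk x z (suc n)

  pad : j ≤ k → Walk G x y j → LazyWalk x y k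
  pad {k = zero} z≤n here = lhere
  pad {k = suc k} z≤n here = lstay (pad z≤n here)
  pad (s≤s j≤k) (step e w) = lstep e (pad j≤k w)

  compress : LazyWalk x y n → Σ ℕ λ k → k ≤ n × Walk G x y k
  compress lhere = 0 , z≤n , here
  compress (lstay l) with compress l
  ... | k , k≤n , w = k , m≤n⇒m≤1+n k≤n , w
  compress (lstep e l) with compress l
  ... | k , k≤n , w = suc k , s≤s k≤n , step e w

  Near : V → V → Set
  Near x y = x ≡ y ⊎ Adj G x y

  nearNear : DecidableEquality V → ∀ {y'} → Simplicial G x → Near x y → Near x y' → Near y y'
  nearNear _≟_ sx (inj₁ refl) n' = n'
  nearNear _≟_ sx (inj₂ e) (inj₁ refl) = inj₂ (symAdj G e)
  nearNear {y = y} _≟_ {y'} sx (inj₂ e) (inj₂ e') with y ≟ y'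
  ... | yes y≡y' = inj₁ y≡y'
  ... | no y≢y' = inj₂ (sx y y' e e' y≢y')

  -- a walk entering and leaving a simplicial vertex can skip it, since
  -- the vertices just before and after it are equal or adjacent
  skip : DecidableEquality V → Simplicial G z → Walk G x z (suc i) → Walk G z y (suc j) →
         Σ ℕ λ k → k < suc i + suc j × Walk G x y k
  skip {i = i} {j = j} _≟_ sz p q with reverse p | q
  ... | step e p' | step e' q' with nearNear _≟_ sz (inj₂ e) (inj₂ e')
  ...   | inj₁ refl = i + j , s≤s (+-monoʳ-≤ i (n≤1+n j)) , append (reverse p') q'
  ...   | inj₂ e'' = i + suc j , ≤-refl , append (reverse p') (step e'' q')

  bypass : DecidableEquality V → Simplicial G z → Walk G x z a → Walk G z y b →
           a ≤ suc i → b ≤ suc j → Σ ℕ λ k → k < suc i + suc j × Walk G x y k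
  bypass {i = i} {j = j} _ _ here q _ b≤ = _ , ≤-<-trans b≤ (m<n+m (suc j) {suc i} (s≤s z≤n)) , q
  bypass {i = i} _ _ p@(step _ _) here a≤ _ = _ , ≤-<-trans a≤ (m<m+n (suc i) (s≤s z≤n)) , p
  bypass _≟_ sz p@(step _ _) q@(step _ _) a≤ b≤ with skip _≟_ sz p q
  ... | k , k< , w = k , <-≤-trans k< (+-mono-≤ a≤ b≤) , w

module Swap {A B : Set} (G : Graph A) (H : Graph B) where

  private variable
    x y z : A × B
    n : ℕ

  swapAdj : Adj (G ⊠ H) x y → Adj (H ⊠ G) (swap x) (swap y)
  swapAdj (inj₁ p) = inj₂ (inj₁ p)
  swapAdj (inj₂ (inj₁ p)) = inj₁ p
  swapAdj (inj₂ (inj₂ (e , f))) = inj₂ (inj₂ (f , e))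

  swapWalk : Walk (G ⊠ H) x y n → Walk (H ⊠ G) (swap x) (swap y) n
  swapWalk here = here
  swapWalk (step e w) = step (swapAdj e) (swapWalk w)

  swapOn : {w : Walk (G ⊠ H) x y n} → OnWalk (G ⊠ H) z w → OnWalk (H ⊠ G) (swap z) (swapWalk w)
  swapOn on-here = on-here
  swapOn (on-there o) = on-there (swapOn o)

module Symmetry {A B : Set} (G : Graph A) (H : Graph B) where
  open Swap G H
  private module Back = Swap H G

  private variable
    x y z : A × B

  swapInterval : Interval (G ⊠ H) x y z → Interval (H ⊠ G) (swap x) (swap y) (swap z)
  swapInterval (k , w , minimal , on) =
    k , swapWalk w , (λ l l<k w' → minimal l l<k (Back.swapWalk w')) , swapOn on

  swapSimplicial : Simplicial (G ⊠ H) x → Simplicial (H ⊠ G) (swap x)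
  swapSimplicial sx y y' e e' y≢y' =
    swapAdj (sx (swap y) (swap y') (Back.swapAdj e) (Back.swapAdj e') (λ eq → y≢y' (cong swap eq)))

  swapExtremeGeodesic : ExtremeGeodesic (G ⊠ H) → ExtremeGeodesic (H ⊠ G)
  swapExtremeGeodesic eg z with eg (swap z)
  ... | u , v , su , sv , I = swap u , swap v , swapSimplicial su , swapSimplicial sv , swapInterval I

module FirstFactor {A B : Set} (G : Graph A) (H : Graph B) where
  private
    module WG = Walks G
    module WH = Walks H
    module WP = Walks (G ⊠ H)

  private variable
    g u v : A
    h e : B
    p q : A × B
    m n : ℕ

  zipLazy : ∀ {a c b d} → Walk G a c n → WH.LazyWalk b d n → Walk (G ⊠ H) (a , b) (c , d) n
  zipLazy here WH.lhere = here
  zipLazy (step e w) (WH.lstay l) = step (inj₂ (inj₁ (refl , e))) (zipLazy w l)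
  zipLazy (step e w) (WH.lstep f l) = step (inj₂ (inj₂ (e , f))) (zipLazy w l)

  zipPadded : ∀ {a c b d} → Walk G a c n → Walk H b d m → m ≤ n → Walk (G ⊠ H) (a , b) (c , d) n
  zipPadded w x m≤n = zipLazy w (WH.pad m≤n x)

  projectLazy : Walk (G ⊠ H) p q n → WG.LazyWalk (proj₁ p) (proj₁ q) n
  projectLazy here = WG.lhere
  projectLazy (step (inj₁ (eq , _)) w) = WG.lstay (subst (λ a → WG.LazyWalk a _ _) (sym eq) (projectLazy w))
  projectLazy (step (inj₂ (inj₁ (_ , e))) w) = WG.lstep e (projectLazy w)
  projectLazy (step (inj₂ (inj₂ (e , _))) w) = WG.lstep e (projectLazy w)

  project : Walk (G ⊠ H) p q n → Σ ℕ λ k → k ≤ n × Walk G (proj₁ p) (proj₁ q) k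
  project w = WG.compress (projectLazy w)

  liftGeodesic : (γ : WG.OnGeodesic u g v) → Walk H h e m → m ≤ WG.before γ ⊓ WG.after γ →
                 Interval (G ⊠ H) (u , e) (v , e) (g , h)
  liftGeodesic {u = u} {v = v} {e = e} (WG.through i j p q minimal) E m≤ =
    WP.interval (WP.through i j (zipPadded p (WH.reverse E) (≤-trans m≤ (m⊓n≤m i j)))
                                (zipPadded q E (≤-trans m≤ (m⊓n≤n i j)))
                                shortest)
    where
    shortest : ∀ l → l < i + j → ¬ Walk (G ⊠ H) (u , e) (v , e) l
    shortest l l<ij w with project w
    ... | k , k≤l , w' = minimal k (≤-<-trans k≤l l<ij) w'

  simplicialFirst : Simplicial (G ⊠ H) p → Simplicial G (proj₁ p)
  simplicialFirst {p = p} sp y y' e e' y≢y'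
    with sp (y , proj₂ p) (y' , proj₂ p) (inj₂ (inj₁ (refl , e))) (inj₂ (inj₁ (refl , e')))
            (λ eq → y≢y' (cong proj₁ eq))
  ... | inj₁ (y≡y' , _) = ⊥-elim (y≢y' y≡y')
  ... | inj₂ (inj₁ (_ , f)) = f
  ... | inj₂ (inj₂ (f , _)) = f

module Product {A B : Set} (G : Graph A) (H : Graph B) where
  open FirstFactor G H
  open Swap G H
  open Symmetry G H
  private
    module Second = FirstFactor H G
    module BackSwap = Swap H G
    module WG = Walks G
    module WH = Walks H
    module WP = Walks (G ⊠ H)

  private variable
    a c g : A
    b d h : B
    p q : A × B
    i j k n : ℕ

  projectSecond : Walk (G ⊠ H) p q n → Σ ℕ λ k → k ≤ n × Walk H (proj₂ p) (proj₂ q) k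
  projectSecond w = Second.project (swapWalk w)

  simplicialSecond : Simplicial (G ⊠ H) p → Simplicial H (proj₂ p)
  simplicialSecond sp = Second.simplicialFirst (swapSimplicial sp)

  productWalk : Walk G a c i → Walk H b d j → Walk (G ⊠ H) (a , b) (c , d) (i ⊔ j)
  productWalk {i = i} {j = j} w x with ≤-total j i
  ... | inj₁ j≤i = subst (Walk (G ⊠ H) _ _) (sym (m≥n⇒m⊔n≡m j≤i)) (zipPadded w x j≤i)
  ... | inj₂ i≤j = subst (Walk (G ⊠ H) _ _) (sym (m≤n⇒m⊔n≡n i≤j))
                     (BackSwap.swapWalk (Second.zipPadded x w i≤j))

  productLowerBound : (∀ l → l < k → ¬ Walk (G ⊠ H) (a , b) (c , d) l) →
                      Walk G a c i → Walk H b d j → i < k → j < k → ⊥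
  productLowerBound minimal w x i<k j<k = minimal _ (⊔-lub i<k j<k) (productWalk w x)

  adjNear : Adj (G ⊠ H) p q → WG.Near (proj₁ p) (proj₁ q) × WH.Near (proj₂ p) (proj₂ q)
  adjNear (inj₁ (eq , f)) = inj₁ eq , inj₂ f
  adjNear (inj₂ (inj₁ (eq , e))) = inj₂ e , inj₁ eq
  adjNear (inj₂ (inj₂ (e , f))) = inj₂ e , inj₂ f

  nearAdj : WG.Near (proj₁ p) (proj₁ q) → WH.Near (proj₂ p) (proj₂ q) → p ≢ q → Adj (G ⊠ H) p q
  nearAdj (inj₁ eq) (inj₁ eq') p≢q = ⊥-elim (p≢q (cong₂ _,_ eq eq'))
  nearAdj (inj₁ eq) (inj₂ f) _ = inj₁ (eq , f)
  nearAdj (inj₂ e) (inj₁ eq) _ = inj₂ (inj₁ (eq , e))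
  nearAdj (inj₂ e) (inj₂ f) _ = inj₂ (inj₂ (e , f))

  -- closed neighbourhoods in G ⊠ H are products of closed neighbourhoods
  productSimplicial : DecidableEquality A → DecidableEquality B →
                      Simplicial G g → Simplicial H h → Simplicial (G ⊠ H) (g , h)
  productSimplicial _≟A_ _≟B_ sg sh y y' e e' y≢y' with adjNear e | adjNear e'
  ... | n₁ , n₂ | n₁' , n₂' = nearAdj (WG.nearNear _≟A_ sg n₁ n₁') (WH.nearNear _≟B_ sh n₂ n₂') y≢y'

  combineGeodesics : DecidableEquality A → DecidableEquality B →
    ∀ {u₁ v₁ u₂ v₂} → Simplicial G u₁ → Simplicial G v₁ → Simplicial H u₂ → Simplicial H v₂ →
    (γ : WG.OnGeodesic u₁ g v₁) → (δ : WH.OnGeodesic u₂ h v₂) →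
    ∃ λ u → ∃ λ v → Simplicial (G ⊠ H) u × Simplicial (G ⊠ H) v × Interval (G ⊠ H) u v (g , h)
  combineGeodesics _≟A_ _≟B_ su₁ sv₁ su₂ sv₂ γ δ
    with ≤-total (WH.before δ ⊓ WH.after δ) (WG.before γ ⊓ WG.after γ)
  ... | inj₁ δ≤γ with WH.nearerEnd su₂ sv₂ δ
  ...   | e , se , E = _ , _ , productSimplicial _≟A_ _≟B_ su₁ se , productSimplicial _≟A_ _≟B_ sv₁ se ,
                       liftGeodesic γ E δ≤γ
  combineGeodesics _≟A_ _≟B_ su₁ sv₁ su₂ sv₂ γ δ | inj₂ γ≤δ with WG.nearerEnd su₁ sv₁ γ
  ...   | e , se , E = _ , _ , productSimplicial _≟A_ _≟B_ se su₂ , productSimplicial _≟A_ _≟B_ se sv₂ ,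
                       Symmetry.swapInterval H G (Second.liftGeodesic δ E γ≤δ)

  projectGeodesic : DecidableEquality B → Simplicial H h → WP.OnGeodesic p (g , h) q →
                    WG.OnGeodesic (proj₁ p) g (proj₁ q) ⊎ (proj₁ p ≡ g ⊎ g ≡ proj₁ q)
  projectGeodesic _ _ (WP.through zero _ P _ _) = inj₂ (inj₁ (cong proj₁ (WP.stationary P)))
  projectGeodesic _ _ (WP.through (suc _) zero _ Q _) = inj₂ (inj₂ (cong proj₁ (WP.stationary Q)))
  projectGeodesic _≟_ sh (WP.through (suc _) (suc _) P Q minimal)
    with project P | project Q | projectSecond P | projectSecond Q
  ... | i , i≤ , Pg | j , j≤ , Qg | a , a≤ , Ph | b , b≤ , Qh with WH.bypass _≟_ sh Ph Qh a≤ b≤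
  ... | c , c< , X = inj₁ (WG.through i j Pg Qg
                             (λ l l< Z → productLowerBound minimal Z X (<-≤-trans l< (+-mono-≤ i≤ j≤)) c<))

  productExtremeGeodesic : DecidableEquality A → DecidableEquality B →
                           ExtremeGeodesic G → ExtremeGeodesic H → ExtremeGeodesic (G ⊠ H)
  productExtremeGeodesic _≟A_ _≟B_ egG egH (g , h) with egG g | egH h
  ... | _ , _ , su₁ , sv₁ , I | _ , _ , su₂ , sv₂ , J =
    combineGeodesics _≟A_ _≟B_ su₁ sv₁ su₂ sv₂ (WG.onGeodesic I) (WH.onGeodesic J)

  -- (⇐) for the first factor; H must be nonempty to have a simplicial vertex
  factorExtremeGeodesic : DecidableEquality B → B → ExtremeGeodesic (G ⊠ H) → ExtremeGeodesic G
  factorExtremeGeodesic _≟_ b₀ eg g with eg (g , b₀)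
  ... | u₀ , _ , su₀ , _ with eg (g , proj₂ u₀)
  ... | u , v , su , sv , I with projectGeodesic _≟_ (simplicialSecond su₀) (WP.onGeodesic I)
  ... | inj₁ γ = _ , _ , simplicialFirst su , simplicialFirst sv , WG.interval γ
  ... | inj₂ (inj₁ refl) = _ , _ , simplicialFirst su , simplicialFirst su , WG.trivialInterval
  ... | inj₂ (inj₂ refl) = _ , _ , simplicialFirst sv , simplicialFirst sv , WG.trivialInterval

someVertex : ∀ {n} → n ≥ 2 → Fin n
someVertex (s≤s _) = fzero

proposition4 : (n m : ℕ) → n ≥ 2 → m ≥ 2 →
    (G : Graph (Fin n)) → (H : Graph (Fin m)) →
    Connected G → Connected H →
    (ExtremeGeodesic G × ExtremeGeodesic H) ⇔ ExtremeGeodesic (G ⊠ H)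
proposition4 n m n≥2 m≥2 G H _ _ = mk⇔
  (λ (egG , egH) → Product.productExtremeGeodesic G H Fin._≟_ Fin._≟_ egG egH)
  (λ eg → Product.factorExtremeGeodesic G H Fin._≟_ (someVertex m≥2) eg ,
          Product.factorExtremeGeodesic H G Fin._≟_ (someVertex n≥2) (Symmetry.swapExtremeGeodesic G H eg))
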